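{- Let $G$ be a finite simple $(K_2+P_4)$-free graph, let $\omega=\omega(G)$, let $A=\{v_1,\dots,v_\omega\}$ be a maximum clique of $G$, and let the sets $C_{i,j}$ ($1\le i<j\le\omega$) and $I_l$ ($1\le l\le\omega$) be defined as in the context. Let $i<j$ with $j\geq 4$. Then: (i) $\langle C_{i,j}\rangle$ is $P_4$-free (and hence perfect); (ii) for $l$ with $j<l\le\omega$, if $H$ is a connected component of $\langle C_{i,j}\rangle$ and some $a\in V(H)$ satisfies $av_l\in E(G)$, then $v_l$ is adjacent to every vertex of $H$; (iii) for $l\leq\omega$, if $a\in C_{i,j}$ and $av_l\notin E(G)$, then $a$ has no neighbour in $I_l$; (iv) if $H$ is a connected component of $\langle C_{i,j}\rangle$, then $\omega(H)\leq |A\setminus N_A(V(H))|$.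
   Context: $K_2+P_4$ is the join of an edge and a path on four vertices (disjoint union plus all edges between the two parts). $\langle S\rangle$ denotes the subgraph induced by $S$; $N(S)$ is the set of neighbours of vertices of $S$, and $N_A(S)=N(S)\cap A$. Let $L=\{(i,j):1\le i<j\le\omega\}$ with lexicographic order: $(i_1,j_1)<_L(i_2,j_2)$ iff $i_1<i_2$, or $i_1=i_2$ and $j_1<j_2$. For $(i,j)\in L$, $C_{i,j}=\{v\in V(G)\setminus A: v\notin N(v_i)\cup N(v_j)\}\setminus \bigcup_{(i',j')<_L(i,j)}C_{i',j'}$. For $1\le l\le\omega$, $I_l=\{v\in V(G)\setminus A: v \text{ is adjacent to every } a\in A\setminus\{v_l\}\}$. -}

module Defs where

open import Data.Nat using (ℕ; _<ᵇ_; _≡ᵇ_; _≤_; _<_)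
open import Data.Bool using (Bool; true; false; _∧_; _∨_)
open import Data.Fin using (Fin; toℕ; zero; suc)
open import Data.Fin.Subset using (Subset; _∈_; ∣_∣)
open import Data.List using (List; []; _∷_; map; concatMap; filterᵇ; allFin; reverse)
open import Data.Product using (Σ; _×_; _,_; ∃)
open import Data.Sum using (_⊎_)
open import Data.Empty using (⊥)
open import Relation.Nullary using (¬_)
open import Relation.Binary.PropositionalEquality using (_≡_; _≢_)
open import Function.Definitions using (Injective)

record Graph : Set where
  field
    n     : ℕ
    E     : Fin n → Fin n → Bool
    sym   : ∀ u v → E u v ≡ E v u
    irr   : ∀ v → E v v ≡ false

module _ (G : Graph) where
  open Graph G

  V : Set
  V = Fin n

  Adj : V → V → Set
  Adj u v = E u v ≡ true

  -- a clique of size k: k vertices, pairwise adjacent (hence distinct)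
  IsClique : ∀ {k} → (Fin k → V) → Set
  IsClique f = ∀ a b → a ≢ b → Adj (f a) (f b)

  InducedCopy : ∀ {k} → (Fin k → Fin k → Bool) → (V → Set) → Set
  InducedCopy {k} P S =
    Σ (Fin k → V) λ f → Injective _≡_ _≡_ f × (∀ a → S (f a)) ×
      (∀ a b → E (f a) (f b) ≡ P a b)

  -- paths inside a vertex set S: Reach S x u = u lies in the connected
  -- component of ⟨S⟩ containing x (for x ∈ S)
  data Reach (S : V → Set) (x : V) : V → Set where
    here : S x → Reach S x x
    step : ∀ {u w} → Reach S x u → S w → Adj u w → Reach S x w

P4 : Fin 4 → Fin 4 → Bool
P4 zero (suc zero) = true
P4 (suc zero) zero = true
P4 (suc zero) (suc (suc zero)) = true
P4 (suc (suc zero)) (suc zero) = true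
P4 (suc (suc zero)) (suc (suc (suc zero))) = true
P4 (suc (suc (suc zero))) (suc (suc zero)) = true
P4 _ _ = false

-- K2 + P4 (join): vertices 0,1 form the K2, vertices 2,3,4,5 the path
-- 2-3-4-5, and every vertex of {0,1} is adjacent to every vertex of {2..5}.
K2+P4 : Fin 6 → Fin 6 → Bool
K2+P4 zero zero = false
K2+P4 (suc zero) (suc zero) = false
K2+P4 zero _ = true
K2+P4 _ zero = true
K2+P4 (suc zero) _ = true
K2+P4 _ (suc zero) = true
K2+P4 (suc (suc a)) (suc (suc b)) = P4 a b

-- The sets C_{i,j} and I_l relative to a clique vs : Fin ω → V
-- (indices are 0-based: vs i is v_{i+1}).

Pair : ℕ → Set
Pair ω = Fin ω × Fin ω

_<Lᵇ_ : ∀ {ω} → Pair ω → Pair ω → Bool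
(i₁ , j₁) <Lᵇ (i₂ , j₂) =
  (toℕ i₁ <ᵇ toℕ i₂) ∨ ((toℕ i₁ ≡ᵇ toℕ i₂) ∧ (toℕ j₁ <ᵇ toℕ j₂))

allPairs : ∀ ω → List (Pair ω)
allPairs ω = concatMap (λ i → map (i ,_) (filterᵇ (λ j → toℕ i <ᵇ toℕ j) (allFin ω)))
                       (allFin ω)

preds : ∀ {ω} → Pair ω → List (Pair ω)
preds {ω} p = reverse (filterᵇ (λ q → q <Lᵇ p) (allPairs ω))

module _ (G : Graph) {ω : ℕ} (vs : Fin ω → V G) where

  InA : V G → Set
  InA v = ∃ λ l → v ≡ vs l

  D : Pair ω → V G → Set
  D (i , j) v = ¬ InA v × ¬ Adj G v (vs i) × ¬ Adj G v (vs j)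

  -- Cl qs p: the set C_p, where qs is the list of all pairs below p
  -- (decreasing order); Un qs: the union of C_q over q in qs.
  mutual
    Cl : List (Pair ω) → Pair ω → V G → Set
    Cl qs p v = D p v × ¬ Un qs v

    Un : List (Pair ω) → V G → Set
    Un [] v = ⊥
    Un (q ∷ qs) v = Cl qs q v ⊎ Un qs v

  C : Fin ω → Fin ω → V G → Set
  C i j = Cl (preds (i , j)) (i , j)

  I : Fin ω → V G → Set
  I l v = ¬ InA v × (∀ m → m ≢ l → Adj G v (vs m))

{-# OPTIONS --safe #-}
module Submission where

-- Choose two indices p, q < j other than i.  Minimality of (i, j) in the
-- lexicographic order makes every vertex of C_{i,j} adjacent to v_p and v_q,
-- and so are the clique vertices v_l and the vertices of I_l for l ∉ {p, q}.
-- An induced P4 built from such vertices would therefore form an induced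
-- K2 + P4 with the edge v_p v_q; (i)-(iii) each exhibit such a P4 in the bad
-- case.  For (iv): by (ii) every vertex of H sees each v_l that some vertex of
-- H sees, so a clique of H extends by all those v_l, and maximality of A
-- bounds it by the number of remaining v_l.

open import Defs
open import Data.Nat using (ℕ; zero; suc; _+_; _≤_; _<_; _<ᵇ_; s≤s; z≤n)
open import Data.Nat.Properties
  using (≤-refl; ≤-trans; ≤-reflexive; +-suc; +-comm; +-monoˡ-≤; +-cancelʳ-≤; <-irrefl; <⇒<ᵇ; ≡⇒≡ᵇ; module ≤-Reasoning)
open import Data.Bool using (Bool; true; false; T)
import Data.Bool as Bool
open import Data.Bool.Properties using (¬-not; T-∨; T-∧)
open import Data.Fin using (Fin; toℕ; zero; suc)
open import Data.Fin.Properties using (_≟_; all?; any?; <-cmp; <-asym; <-trans; <⇒≢; suc-injective)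
open import Data.Fin.Subset using (Subset; _∈_; _∉_; ∣_∣; inside; outside)
import Data.Vec as Vec
open import Data.Vec.Functional using ([]; _∷_; tail)
open import Data.List using (List; allFin; filterᵇ; map)
open import Data.List.Relation.Unary.Any using (here; there)
import Data.List.Relation.Unary.Any as Any
open import Data.List.Relation.Unary.Any.Properties using (reverse⁺)
import Data.List.Membership.Propositional as List
open import Data.List.Membership.Propositional.Properties using (∈-concatMap⁺; ∈-map⁺; ∈-filter⁺; ∈-allFin)
open import Data.Product using (_×_; _,_; proj₁; proj₂; ∃; ∃₂)
open import Data.Sum using (_⊎_; inj₁; inj₂)
open import Data.Unit using (⊤; tt)
open import Data.Empty using (⊥)
open import Function using (_∘_)
open import Function.Bundles using (_⇔_; Equivalence)
open import Function.Definitions using (Injective)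
open import Relation.Nullary using (¬_; Dec; yes; no; contradiction)
open import Relation.Nullary.Decidable using (from-yes; ¬?; _→-dec_; _⊎-dec_; decidable-stable; T?)
open import Relation.Binary.Definitions using (Tri; tri<; tri≈; tri>)
open import Relation.Binary.PropositionalEquality using (_≡_; _≢_; refl; sym; trans; cong)

NoFalseTwins : ∀ {k} → (Fin k → Fin k → Bool) → Set
NoFalseTwins P = ∀ a b → a ≢ b → P a b ≡ true ⊎ ∃ λ c → P a c ≢ P b c

noFalseTwins? : ∀ {k} (P : Fin k → Fin k → Bool) → Dec (NoFalseTwins P)
noFalseTwins? P = all? λ a → all? λ b → ¬? (a ≟ b) →-dec
  ((P a b Bool.≟ true) ⊎-dec any? λ c → ¬? (P a c Bool.≟ P b c))

K2+P4-noFalseTwins : NoFalseTwins K2+P4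
K2+P4-noFalseTwins = from-yes (noFalseTwins? K2+P4)

module _ (G : Graph) where
  open Graph G using (E; irr)

  Adj-sym : ∀ {u v} → Adj G u v → Adj G v u
  Adj-sym {u} {v} = trans (Graph.sym G v u)

  adj? : ∀ u v → Dec (Adj G u v)
  adj? u v = E u v Bool.≟ true

  ¬Adj⇒E≡false : ∀ {u v} → ¬ Adj G u v → E u v ≡ false
  ¬Adj⇒E≡false = ¬-not

  copy-injective : ∀ {k} {P : Fin k → Fin k → Bool} → NoFalseTwins P
    → (f : Fin k → V G) → (∀ a b → E (f a) (f b) ≡ P a b) → Injective _≡_ _≡_ f
  copy-injective {P = P} twins f copy {a} {b} fa≡fb with a ≟ b
  ... | yes a≡b = a≡b
  ... | no a≢b with twins a b a≢b
  ... | inj₁ Pab = contradiction (trans (sym Pab) (trans (sym (copy a b)) loop)) λ ()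
    where
      loop : E (f a) (f b) ≡ false
      loop = trans (cong (E (f a)) (sym fa≡fb)) (irr (f a))
  ... | inj₂ (c , Pac≢Pbc) =
    contradiction (trans (sym (copy a c)) (trans (cong (λ z → E z (f c)) fa≡fb) (copy b c))) Pac≢Pbc

  path : V G → V G → V G → V G → Fin 4 → V G
  path a b c d = a ∷ b ∷ c ∷ d ∷ []

  path-induces-P4 : ∀ {a b c d} → Adj G a b → Adj G b c → Adj G c d
    → ¬ Adj G a c → ¬ Adj G a d → ¬ Adj G b d
    → ∀ x y → E (path a b c d x) (path a b c d y) ≡ P4 x y
  path-induces-P4 {a} {b} {c} {d} ab bc cd a≁c a≁d b≁d = go
    where
      go : ∀ x y → E (path a b c d x) (path a b c d y) ≡ P4 x y
      go zero                   zero                   = irr a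
      go zero                   (suc zero)             = ab
      go zero                   (suc (suc zero))       = ¬Adj⇒E≡false a≁c
      go zero                   (suc (suc (suc zero))) = ¬Adj⇒E≡false a≁d
      go (suc zero)             zero                   = Adj-sym ab
      go (suc zero)             (suc zero)             = irr b
      go (suc zero)             (suc (suc zero))       = bc
      go (suc zero)             (suc (suc (suc zero))) = ¬Adj⇒E≡false b≁d
      go (suc (suc zero))       zero                   = ¬Adj⇒E≡false (a≁c ∘ Adj-sym)
      go (suc (suc zero))       (suc zero)             = Adj-sym bc
      go (suc (suc zero))       (suc (suc zero))       = irr c
      go (suc (suc zero))       (suc (suc (suc zero))) = cd
      go (suc (suc (suc zero))) zero                   = ¬Adj⇒E≡false (a≁d ∘ Adj-sym)
      go (suc (suc (suc zero))) (suc zero)             = ¬Adj⇒E≡false (b≁d ∘ Adj-sym)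
      go (suc (suc (suc zero))) (suc (suc zero))       = Adj-sym cd
      go (suc (suc (suc zero))) (suc (suc (suc zero))) = irr d

  P4-under-edge⇒K2+P4 : ∀ {y₁ y₂} (h : Fin 4 → V G) → (∀ a b → E (h a) (h b) ≡ P4 a b)
    → Adj G y₁ y₂ → (∀ a → Adj G (h a) y₁) → (∀ a → Adj G (h a) y₂)
    → InducedCopy G K2+P4 (λ _ → ⊤)
  P4-under-edge⇒K2+P4 {y₁} {y₂} h h-P4 y₁y₂ h~y₁ h~y₂ =
    f , copy-injective K2+P4-noFalseTwins f copy , (λ _ → tt) , copy
    where
      f : Fin 6 → V G
      f = y₁ ∷ y₂ ∷ h
      copy : ∀ a b → E (f a) (f b) ≡ K2+P4 a b
      copy zero          zero          = irr y₁
      copy zero          (suc zero)    = y₁y₂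
      copy zero          (suc (suc b)) = Adj-sym (h~y₁ b)
      copy (suc zero)    zero          = Adj-sym y₁y₂
      copy (suc zero)    (suc zero)    = irr y₂
      copy (suc zero)    (suc (suc b)) = Adj-sym (h~y₂ b)
      copy (suc (suc a)) zero          = h~y₁ a
      copy (suc (suc a)) (suc zero)    = h~y₂ a
      copy (suc (suc a)) (suc (suc b)) = h-P4 a b

  Reach⇒∈ : ∀ {S x u} → Reach G S x u → S u
  Reach⇒∈ (here x∈S) = x∈S
  Reach⇒∈ (step _ w∈S _) = w∈S

  Reach-propagate : ∀ {S Q : V G → Set} → (∀ {u w} → S u → S w → Adj G u w → Q u → Q w)
    → ∀ {x a u} → Reach G S x a → Q a → Reach G S x u → Q u
  Reach-propagate {S} {Q} along {x} ra Qa ru = forward ru (backward ra Qa)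
    where
      backward : ∀ {a} → Reach G S x a → Q a → Q x
      backward (here _) Qx = Qx
      backward (step r w∈S uw) Qw = backward r (along w∈S (Reach⇒∈ r) (Adj-sym uw) Qw)
      forward : ∀ {u} → Reach G S x u → Q x → Q u
      forward (here _) Qx = Qx
      forward (step r w∈S uw) Qx = along (Reach⇒∈ r) w∈S uw (forward r Qx)

  IsClique-cons : ∀ {k u} {f : Fin k → V G} → IsClique G f → (∀ t → Adj G u (f t))
    → IsClique G (u ∷ f)
  IsClique-cons f-clique u~f zero    zero    0≢0   = contradiction refl 0≢0
  IsClique-cons f-clique u~f zero    (suc b) _     = u~f b
  IsClique-cons f-clique u~f (suc a) zero    _     = Adj-sym (u~f a)
  IsClique-cons f-clique u~f (suc a) (suc b) sa≢sb = f-clique a b (sa≢sb ∘ cong suc)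

  IsClique-tail : ∀ {k} {f : Fin (suc k) → V G} → IsClique G f → IsClique G (tail f)
  IsClique-tail f-clique a b a≢b = f-clique (suc a) (suc b) (a≢b ∘ suc-injective)

  clique-join-outside : ∀ {n k} (T : Subset n) {ws : Fin n → V G} → IsClique G ws
    → {f : Fin k → V G} → IsClique G f → (∀ t l → l ∉ T → Adj G (f t) (ws l))
    → ∃₂ λ m (g : Fin m → V G) → IsClique G g × k + n ≤ m + ∣ T ∣
  clique-join-outside Vec.[] _ f-clique _ = _ , _ , f-clique , ≤-refl
  clique-join-outside {suc n} {k} (outside Vec.∷ T) {ws} ws-clique {f} f-clique f~ws
    with clique-join-outside T (IsClique-tail ws-clique)
           (IsClique-cons f-clique λ t → Adj-sym (f~ws t zero λ ())) f'~ws'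
    where
      f'~ws' : ∀ t l → l ∉ T → Adj G ((ws zero ∷ f) t) (ws (suc l))
      f'~ws' zero    l _   = ws-clique zero (suc l) λ ()
      f'~ws' (suc t) l l∉T = f~ws t (suc l) λ { (Vec.there l∈T) → l∉T l∈T }
  ... | m , g , g-clique , le = m , g , g-clique , ≤-trans (≤-reflexive (+-suc k n)) le
  clique-join-outside {suc n} {k} (inside Vec.∷ T) ws-clique f-clique f~ws
    with clique-join-outside T (IsClique-tail ws-clique) f-clique
           (λ t l l∉T → f~ws t (suc l) λ { (Vec.there l∈T) → l∉T l∈T })
  ... | m , g , g-clique , le =
    m , g , g-clique , ≤-trans (≤-reflexive (+-suc k n)) (≤-trans (s≤s le) (≤-reflexive (sym (+-suc m ∣ T ∣))))

  module _ {n} {ws : Fin n → V G} (ws-clique : IsClique G ws)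
           (ws-maximum : ∀ k (f : Fin k → V G) → IsClique G f → k ≤ n) where

    clique-complete-outside-maximum-clique⇒≤ : (T : Subset n) → ∀ {k} {f : Fin k → V G}
      → IsClique G f → (∀ t l → l ∉ T → Adj G (f t) (ws l)) → k ≤ ∣ T ∣
    clique-complete-outside-maximum-clique⇒≤ T {k} f-clique f~ws
      with clique-join-outside T ws-clique f-clique f~ws
    ... | m , g , g-clique , k+n≤m+∣T∣ = +-cancelʳ-≤ n k ∣ T ∣ (begin
      k + n      ≤⟨ k+n≤m+∣T∣ ⟩
      m + ∣ T ∣  ≤⟨ +-monoˡ-≤ ∣ T ∣ (ws-maximum m g g-clique) ⟩
      n + ∣ T ∣  ≡⟨ +-comm n ∣ T ∣ ⟩
      ∣ T ∣ + n  ∎)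
      where open ≤-Reasoning

    maximum-clique-has-no-common-neighbour : ∀ u → ¬ (∀ l → Adj G u (ws l))
    maximum-clique-has-no-common-neighbour u u~ws =
      <-irrefl refl (ws-maximum (suc n) (u ∷ ws) (IsClique-cons ws-clique u~ws))

module _ (G : Graph) {ω : ℕ} (vs : Fin ω → V G) where

  -- Un is only recognisable up to double negation: C_q is itself defined by a negation.
  D⇒¬¬Un : ∀ {v q qs} → q List.∈ qs → D G vs q v → ¬ ¬ Un G vs qs v
  D⇒¬¬Un (here refl)   Dv ¬Un = ¬Un (inj₁ (Dv , ¬Un ∘ inj₂))
  D⇒¬¬Un (there q∈qs) Dv ¬Un = D⇒¬¬Un q∈qs Dv (¬Un ∘ inj₂)

  <L-first : ∀ {m n i j : Fin ω} → toℕ m < toℕ i → T ((m , n) <Lᵇ (i , j))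
  <L-first m<i = Equivalence.from T-∨ (inj₁ (<⇒<ᵇ m<i))

  <L-second : ∀ {n i j : Fin ω} → toℕ n < toℕ j → T ((i , n) <Lᵇ (i , j))
  <L-second {i = i} n<j =
    Equivalence.from T-∨ (inj₂ (Equivalence.from T-∧ (≡⇒≡ᵇ (toℕ i) (toℕ i) refl , <⇒<ᵇ n<j)))

  ∈-preds : ∀ {p m n} → toℕ m < toℕ n → T ((m , n) <Lᵇ p) → (m , n) List.∈ preds p
  ∈-preds {p} {m} {n} m<n mn<p =
    reverse⁺ (∈-filter⁺ (λ q → T? (q <Lᵇ p)) (∈-concatMap⁺ row (Any.map in-row (∈-allFin m))) mn<p)
    where
      row : Fin ω → List (Pair ω)
      row m' = map (m' ,_) (filterᵇ (λ n' → toℕ m' <ᵇ toℕ n') (allFin ω))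
      in-row : ∀ {m'} → m ≡ m' → (m , n) List.∈ row m'
      in-row refl = ∈-map⁺ (m ,_) (∈-filter⁺ (λ n' → T? (toℕ m <ᵇ toℕ n')) (∈-allFin n) (<⇒<ᵇ m<n))

  module _ {i j : Fin ω} {v : V G} (v∈C : C G vs i j v) where

    C⇒¬D-earlier : ∀ {m n} → toℕ m < toℕ n → T ((m , n) <Lᵇ (i , j)) → ¬ D G vs (m , n) v
    C⇒¬D-earlier m<n mn<ij Dv = D⇒¬¬Un (∈-preds {i , j} m<n mn<ij) Dv (proj₂ v∈C)

    C⇒¬Adj-i : ¬ Adj G v (vs i)
    C⇒¬Adj-i = proj₁ (proj₂ (proj₁ v∈C))

    C⇒¬Adj-j : ¬ Adj G v (vs j)
    C⇒¬Adj-j = proj₂ (proj₂ (proj₁ v∈C))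

    C⇒Adj : ∀ {m} → toℕ m < toℕ j → m ≢ i → Adj G v (vs m)
    C⇒Adj {m} m<j m≢i = decidable-stable (adj? G v (vs m)) (by-position (<-cmp m i))
      where
        by-position : Tri (toℕ m < toℕ i) (m ≡ i) (toℕ i < toℕ m) → ¬ ¬ Adj G v (vs m)
        by-position (tri< m<i _ _) v≁m =
          C⇒¬D-earlier m<i (<L-first {i = i} {j} m<i) (proj₁ (proj₁ v∈C) , v≁m , C⇒¬Adj-i)
        by-position (tri≈ _ m≡i _) _ = m≢i m≡i
        by-position (tri> _ _ i<m) v≁m =
          C⇒¬D-earlier i<m (<L-second {i = i} m<j) (proj₁ (proj₁ v∈C) , C⇒¬Adj-i , v≁m)

module C-structure (G : Graph) (K2+P4-free : ¬ InducedCopy G K2+P4 (λ _ → ⊤))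
  {ω : ℕ} (vs : Fin ω → V G) (vs-clique : IsClique G vs)
  (vs-maximum : ∀ k (f : Fin k → V G) → IsClique G f → k ≤ ω)
  (i j : Fin ω) (i<j : toℕ i < toℕ j) (3≤j : 3 ≤ toℕ j) where

  open Graph G using (E)

  Hub : Fin ω → Set
  Hub m = toℕ m < toℕ j × m ≢ i

  ¬Hub-i : ¬ Hub i
  ¬Hub-i (_ , i≢i) = i≢i refl

  ¬Hub-j : ¬ Hub j
  ¬Hub-j (j<j , _) = <-irrefl refl j<j

  two-hubs : ∃₂ λ p q → p ≢ q × Hub p × Hub q
  two-hubs = pick i j 3≤j
    where
      pick : ∀ {n} (i j : Fin n) → 3 ≤ toℕ j → ∃₂ λ p q → p ≢ q × (toℕ p < toℕ j × p ≢ i) × (toℕ q < toℕ j × q ≢ i)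
      pick zero                (suc (suc (suc _))) (s≤s (s≤s (s≤s _))) =
        suc zero , suc (suc zero) , (λ ()) , (s≤s (s≤s z≤n) , λ ()) , (s≤s (s≤s (s≤s z≤n)) , λ ())
      pick (suc zero)          (suc (suc (suc _))) (s≤s (s≤s (s≤s _))) =
        zero , suc (suc zero) , (λ ()) , (s≤s z≤n , λ ()) , (s≤s (s≤s (s≤s z≤n)) , λ ())
      pick (suc (suc _))       (suc (suc (suc _))) (s≤s (s≤s (s≤s _))) =
        zero , suc zero , (λ ()) , (s≤s z≤n , λ ()) , (s≤s (s≤s z≤n) , λ ())

  HubComplete : V G → Set
  HubComplete v = ∀ m → Hub m → Adj G v (vs m)

  C⇒HubComplete : ∀ {v} → C G vs i j v → HubComplete v
  C⇒HubComplete v∈C m (m<j , m≢i) = C⇒Adj G vs v∈C m<j m≢i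

  ¬Hub⇒HubComplete : ∀ {l} → ¬ Hub l → HubComplete (vs l)
  ¬Hub⇒HubComplete ¬hub m hub = Adj-sym G (vs-clique m _ λ { refl → ¬hub hub })

  I⇒HubComplete : ∀ {l u} → I G vs l u → ¬ Hub l → HubComplete u
  I⇒HubComplete (_ , u~A) ¬hub m hub = u~A m λ { refl → ¬hub hub }

  no-HubComplete-P4 : (h : Fin 4 → V G) → (∀ a b → E (h a) (h b) ≡ P4 a b)
    → (∀ a → HubComplete (h a)) → ⊥
  no-HubComplete-P4 h h-P4 h-hc with two-hubs
  ... | p , q , p≢q , hub-p , hub-q = K2+P4-free
    (P4-under-edge⇒K2+P4 G h h-P4 (vs-clique p q p≢q) (λ a → h-hc a p hub-p) (λ a → h-hc a q hub-q))

  no-HubComplete-path : ∀ {a b c d} → Adj G a b → Adj G b c → Adj G c d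
    → ¬ Adj G a c → ¬ Adj G a d → ¬ Adj G b d
    → HubComplete a → HubComplete b → HubComplete c → HubComplete d → ⊥
  no-HubComplete-path ab bc cd a≁c a≁d b≁d ha hb hc hd =
    no-HubComplete-P4 _ (path-induces-P4 G ab bc cd a≁c a≁d b≁d)
      λ { zero → ha ; (suc zero) → hb ; (suc (suc zero)) → hc ; (suc (suc (suc zero))) → hd }

  C-P4-free : ¬ InducedCopy G P4 (C G vs i j)
  C-P4-free (h , _ , h∈C , h-P4) = no-HubComplete-P4 h h-P4 (C⇒HubComplete ∘ h∈C)

  j<⇒¬Hub : ∀ {l} → toℕ j < toℕ l → ¬ Hub l
  j<⇒¬Hub j<l (l<j , _) = <-asym l<j j<l

  module _ {l : Fin ω} (j<l : toℕ j < toℕ l) where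

    C-edge-preserves-Adj : ∀ {u w} → C G vs i j u → C G vs i j w → Adj G u w
      → Adj G u (vs l) → Adj G w (vs l)
    C-edge-preserves-Adj u∈C w∈C uw ul = decidable-stable (adj? G _ _) λ w≁l →
      no-HubComplete-path (Adj-sym G uw) ul (vs-clique l i (<⇒≢ (<-trans i<j j<l) ∘ sym))
        w≁l (C⇒¬Adj-i G vs w∈C) (C⇒¬Adj-i G vs u∈C)
        (C⇒HubComplete w∈C) (C⇒HubComplete u∈C) (¬Hub⇒HubComplete (j<⇒¬Hub j<l)) (¬Hub⇒HubComplete ¬Hub-i)

    C-component-Adj : ∀ {x a u} → Reach G (C G vs i j) x a → Adj G a (vs l)
      → Reach G (C G vs i j) x u → Adj G u (vs l)
    C-component-Adj = Reach-propagate G C-edge-preserves-Adj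

  C-component-¬Adj : ∀ l {x a u} → Reach G (C G vs i j) x a → ¬ Adj G a (vs l)
    → Reach G (C G vs i j) x u → ¬ Adj G u (vs l)
  C-component-¬Adj l ra a≁l ru with <-cmp l j
  ... | tri> _ _ j<l = λ u~l → a≁l (C-component-Adj j<l ru u~l ra)
  ... | tri≈ _ refl _ = C⇒¬Adj-j G vs (Reach⇒∈ G ru)
  ... | tri< l<j _ _ with l ≟ i
  ...   | yes refl = C⇒¬Adj-i G vs (Reach⇒∈ G ru)
  ...   | no l≢i = contradiction (C⇒Adj G vs (Reach⇒∈ G ra) l<j l≢i) a≁l

  I⇒¬Adj : ∀ {l u} → I G vs l u → ¬ Adj G u (vs l)
  I⇒¬Adj {l} {u} (_ , u~A) u~l = maximum-clique-has-no-common-neighbour G vs-clique vs-maximum u u~vs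
    where
      u~vs : ∀ m → Adj G u (vs m)
      u~vs m with m ≟ l
      ... | yes refl = u~l
      ... | no m≢l = u~A m m≢l

  nonHub-endpoint : ∀ l → ∃ λ p → p ≢ l × ¬ Hub p × (∀ {v} → C G vs i j v → ¬ Adj G v (vs p))
  nonHub-endpoint l with l ≟ i
  ... | yes refl = j , (<⇒≢ i<j ∘ sym) , ¬Hub-j , C⇒¬Adj-j G vs
  ... | no l≢i = i , (l≢i ∘ sym) , ¬Hub-i , C⇒¬Adj-i G vs

  C-¬Adj⇒¬Adj-I : ∀ l {a} → C G vs i j a → ¬ Adj G a (vs l) → ∀ u → I G vs l u → ¬ Adj G a u
  C-¬Adj⇒¬Adj-I l a∈C a≁l u u∈I au with nonHub-endpoint l
  ... | p , p≢l , ¬Hub-p , C≁p =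
    no-HubComplete-path au (proj₂ u∈I p p≢l) (vs-clique p l p≢l) (C≁p a∈C) a≁l (I⇒¬Adj u∈I)
      (C⇒HubComplete a∈C) (I⇒HubComplete u∈I ¬Hub-l) (¬Hub⇒HubComplete ¬Hub-p) (¬Hub⇒HubComplete ¬Hub-l)
    where
      ¬Hub-l : ¬ Hub l
      ¬Hub-l hub = a≁l (C⇒HubComplete a∈C l hub)

  C-component-clique-bound : ∀ {x} (T : Subset ω)
    → (∀ l → (l ∈ T) ⇔ (∀ u → Reach G (C G vs i j) x u → ¬ Adj G u (vs l)))
    → ∀ k (f : Fin k → V G) → (∀ t → Reach G (C G vs i j) x (f t)) → IsClique G f → k ≤ ∣ T ∣
  C-component-clique-bound T T-def k f f-reach f-clique =
    clique-complete-outside-maximum-clique⇒≤ G vs-clique vs-maximum T f-clique λ t l l∉T →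
      decidable-stable (adj? G _ _) λ ft≁l →
        l∉T (Equivalence.from (T-def l) λ u → C-component-¬Adj l (f-reach t) ft≁l)

lemma2p5 : (G : Graph) → ¬ InducedCopy G K2+P4 (λ _ → ⊤)
    → (ω : ℕ) (vs : Fin ω → V G) → IsClique G vs
    → (∀ k (f : Fin k → V G) → IsClique G f → k ≤ ω)
    → (i j : Fin ω) → toℕ i < toℕ j → 3 ≤ toℕ j
    → (¬ InducedCopy G P4 (C G vs i j))
      × (∀ (l : Fin ω) → toℕ j < toℕ l → ∀ x a → C G vs i j x
           → Reach G (C G vs i j) x a → Adj G a (vs l)
           → ∀ u → Reach G (C G vs i j) x u → Adj G u (vs l))
      × (∀ (l : Fin ω) a → C G vs i j a → ¬ Adj G a (vs l)
           → ∀ u → I G vs l u → ¬ Adj G a u)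
      × (∀ x → C G vs i j x → (T : Subset ω)
           → (∀ l → (l ∈ T) ⇔ (∀ u → Reach G (C G vs i j) x u → ¬ Adj G u (vs l)))
           → ∀ k (f : Fin k → V G) → (∀ t → Reach G (C G vs i j) x (f t))
           → IsClique G f → k ≤ ∣ T ∣)
lemma2p5 G K2+P4-free ω vs vs-clique vs-maximum i j i<j 3≤j =
    C-P4-free
  , (λ l j<l _ _ _ ra al _ ru → C-component-Adj j<l ra al ru)
  , (λ l _ → C-¬Adj⇒¬Adj-I l)
  , (λ _ _ → C-component-clique-bound)
  where open C-structure G K2+P4-free vs vs-clique vs-maximum i j i<j 3≤j
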